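{- Let $m\ge 2$, let $X_1,\ldots,X_m\subseteq\mathbb{Z}^{+}$ be finite nonempty sets, and write $X_k=\{x_{k1},\ldots,x_{k|X_k|}\}$. For $1\le i\le m$ and $j\in\mathbb{Z}$ let \[ z_i(j)=\#\Big\{(\ell_1,\ldots,\ell_i)\;:\;1\le \ell_k\le |X_k|\text{ for all }k,\ \sum_{k=1}^{i}x_{k\ell_k}\ge j\Big\}. \] Let $K\ge 1$, let $2\le i\le m$, and let $\tilde z_{i-1}:\mathbb{Z}\to\mathbb{R}$ be a nonincreasing $K$-approximation function of $z_{i-1}$. Define $\bar z_i(j)=\sum_{k=1}^{|X_i|}\tilde z_{i-1}(j-x_{ik})$ for $j\in\mathbb{Z}$. Then $\bar z_i$ is a nonincreasing $K$-approximation function of $z_i$.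
   Context: For a function $f:S\to\mathbb{R}^{+}$ and $K\ge1$, a function $\tilde f$ on $S$ is a $K$-approximation function of $f$ if $f(x)\le\tilde f(x)\le K f(x)$ for every $x\in S$. $\mathbb{Z}^{+}=\{0,1,2,\ldots\}$. -}

module Defs where

open import Level using (0ℓ)
open import Data.Nat as ℕ using (ℕ; zero; suc)
open import Data.Integer as ℤ using (ℤ)
open import Data.List using (List; []; _∷_; [_]; map; concatMap; foldr; length; filter; _∷ʳ_)
open import Data.Product using (∃; _×_)
open import Relation.Nullary using (¬_)
open import Relation.Binary using (Rel; IsTotalOrder)
open import Relation.Binary.PropositionalEquality using (_≡_)
open import Algebra.Structures using (IsCommutativeRing)

-- An axiomatisation of the real numbers: a complete ordered field
-- (any two models are isomorphic, so quantifying over all models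
-- is the same as talking about ℝ).
record RealField : Set₁ where
  infixl 6 _+_
  infixl 7 _*_
  infix 4 _≤_
  field
    Carrier : Set
    _+_ _*_ : Carrier → Carrier → Carrier
    -_ : Carrier → Carrier
    0# 1# : Carrier
    _≤_ : Rel Carrier 0ℓ
    isCommutativeRing : IsCommutativeRing _≡_ _+_ _*_ -_ 0# 1#
    isTotalOrder : IsTotalOrder _≡_ _≤_
    0≢1 : ¬ (0# ≡ 1#)
    inverse : ∀ x → ¬ (x ≡ 0#) → ∃ λ y → x * y ≡ 1#
    +-monoˡ-≤ : ∀ {x y} z → x ≤ y → x + z ≤ y + z
    *-nonneg : ∀ {x y} → 0# ≤ x → 0# ≤ y → 0# ≤ x * y
    complete : (P : Carrier → Set) → ∃ P → (∃ λ b → ∀ x → P x → x ≤ b) →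
               ∃ λ s → (∀ x → P x → x ≤ s) × (∀ b → (∀ x → P x → x ≤ b) → s ≤ b)

  fromℕ : ℕ → Carrier
  fromℕ zero = 0#
  fromℕ (suc n) = 1# + fromℕ n

  sumR : List Carrier → Carrier
  sumR = foldr _+_ 0#

-- The sets X_1, X_2, ... are given as X : ℕ → List ℕ (1-based; X k for
-- 1 ≤ k ≤ m is the list x_{k1},…,x_{k|X_k|} of the elements of X_k).
-- choices X i = list of all tuples (x_{1ℓ₁},…,x_{iℓᵢ}), one per index tuple (ℓ₁,…,ℓᵢ).
choices : (ℕ → List ℕ) → ℕ → List (List ℕ)
choices X zero = [ [] ]
choices X (suc i) = concatMap (λ t → map (λ x → t ∷ʳ x) (X (suc i))) (choices X i)

sumℕ : List ℕ → ℕ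
sumℕ = foldr ℕ._+_ 0

z : (ℕ → List ℕ) → ℕ → ℤ → ℕ
z X i j = length (filter (λ t → j ℤ.≤? ℤ.+ (sumℕ t)) (choices X i))

module _ (R : RealField) where
  open RealField R

  Nonincreasing : (ℤ → Carrier) → Set
  Nonincreasing f = ∀ j j' → j ℤ.≤ j' → f j' ≤ f j

  IsKApprox : Carrier → (ℤ → Carrier) → (ℤ → ℕ) → Set
  IsKApprox K f̃ f = ∀ j → (fromℕ (f j) ≤ f̃ j) × (f̃ j ≤ K * fromℕ (f j))

-- Extending an (i-1)-tuple by x_{iℓ} raises its sum by x_{iℓ}, so sorting i-tuples by
-- their last index gives z_i(j) = Σ_ℓ z_{i-1}(j - x_{iℓ}). Thus z̄_i is the same sum
-- with z_{i-1} replaced by z̃_{i-1}: the termwise bounds z_{i-1} ≤ z̃_{i-1} ≤ K z_{i-1}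
-- add up, and shifts of a nonincreasing function are nonincreasing.
module Submission where

open import Defs
open import Data.Nat using (ℕ; _≤_; _∸_)
open import Data.Integer using (ℤ; _-_; +_)
open import Data.List using (List; []; map)
open import Data.List.Relation.Unary.Unique.Propositional using (Unique)
open import Data.Product using (_×_)
open import Relation.Nullary using (¬_)
open import Relation.Binary.PropositionalEquality using (_≡_)

open import Algebra.Bundles using (AbelianGroup)
open import Algebra.Structures using (IsCommutativeRing)
open import Data.Nat as ℕ using (zero; suc; s≤s)
import Data.Nat.Properties as ℕ
open import Data.Nat.ListAction.Properties using (sum-++)
import Data.Integer as ℤ
import Data.Integer.Properties as ℤ
open import Data.List using (_∷_; [_]; _++_; _∷ʳ_; length; filter; concatMap)
open import Data.List.Properties using (length-++; map-cong; filter-++; filter-accept; filter-reject)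
open import Data.Product using (_,_)
open import Function using (_∘_; _⇔_; mk⇔; Equivalence)
open import Relation.Binary using (IsTotalOrder)
open import Relation.Binary.PropositionalEquality
  using (refl; sym; trans; cong; cong₂; subst; subst₂; module ≡-Reasoning)
open import Relation.Nullary using (Dec; yes; no)

open import Algebra.Properties.CommutativeSemigroup ℕ.+-commutativeSemigroup using (interchange)
open import Algebra.Properties.Group (AbelianGroup.group ℤ.+-0-abelianGroup)
  using (//-rightDividesˡ; //-rightDividesʳ)

≤+⇔-≤ : ∀ {i j k} → j ℤ.≤ i ℤ.+ k ⇔ j - k ℤ.≤ i
≤+⇔-≤ {i} {j} {k} = mk⇔
  (λ j≤i+k → subst (j - k ℤ.≤_) (//-rightDividesʳ k i) (ℤ.+-monoˡ-≤ (ℤ.- k) j≤i+k))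
  (λ j-k≤i → subst (ℤ._≤ i ℤ.+ k) (//-rightDividesˡ k j) (ℤ.+-monoˡ-≤ k j-k≤i))

sumℕ-∷ʳ : ∀ t x → sumℕ (t ∷ʳ x) ≡ sumℕ t ℕ.+ x
sumℕ-∷ʳ t x = trans (sum-++ t [ x ]) (cong (sumℕ t ℕ.+_) (ℕ.+-identityʳ x))

sumℕ-map-+ : ∀ {A : Set} (f g : A → ℕ) xs →
  sumℕ (map (λ x → f x ℕ.+ g x) xs) ≡ sumℕ (map f xs) ℕ.+ sumℕ (map g xs)
sumℕ-map-+ f g [] = refl
sumℕ-map-+ f g (x ∷ xs) =
  trans (cong (f x ℕ.+ g x ℕ.+_) (sumℕ-map-+ f g xs)) (interchange (f x) (g x) _ _)

sumℕ-map-0 : ∀ {A : Set} (xs : List A) → sumℕ (map (λ _ → 0) xs) ≡ 0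
sumℕ-map-0 [] = refl
sumℕ-map-0 (x ∷ xs) = sumℕ-map-0 xs

sum≥? : ∀ j (t : List ℕ) → Dec (j ℤ.≤ + sumℕ t)
sum≥? j t = j ℤ.≤? + sumℕ t

atLeast : ℤ → List (List ℕ) → ℕ
atLeast j = length ∘ filter (sum≥? j)

atLeast-++ : ∀ j ts us → atLeast j (ts ++ us) ≡ atLeast j ts ℕ.+ atLeast j us
atLeast-++ j ts us =
  trans (cong length (filter-++ (sum≥? j) ts us)) (length-++ (filter _ ts))

atLeast-map : ∀ {A : Set} j (f : A → List ℕ) xs →
  atLeast j (map f xs) ≡ sumℕ (map (λ x → atLeast j [ f x ]) xs)
atLeast-map j f [] = refl
atLeast-map j f (x ∷ xs) =
  trans (atLeast-++ j [ f x ] (map f xs)) (cong (atLeast j [ f x ] ℕ.+_) (atLeast-map j f xs))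

≤+sumℕ-∷ʳ⇔ : ∀ {j} t x → j ℤ.≤ + sumℕ (t ∷ʳ x) ⇔ j - + x ℤ.≤ + sumℕ t
≤+sumℕ-∷ʳ⇔ t x rewrite sumℕ-∷ʳ t x = ≤+⇔-≤

atLeast-map-∷ʳ : ∀ j x ts → atLeast j (map (_∷ʳ x) ts) ≡ atLeast (j - + x) ts
atLeast-map-∷ʳ j x [] = refl
atLeast-map-∷ʳ j x (t ∷ ts) with (j - + x) ℤ.≤? + sumℕ t
... | yes j-x≤t =
  trans (cong length (filter-accept (sum≥? j) (Equivalence.from (≤+sumℕ-∷ʳ⇔ t x) j-x≤t)))
        (cong suc (atLeast-map-∷ʳ j x ts))
... | no  j-x≰t =
  trans (cong length (filter-reject (sum≥? j) (j-x≰t ∘ Equivalence.to (≤+sumℕ-∷ʳ⇔ t x))))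
        (atLeast-map-∷ʳ j x ts)

atLeast-extensions : ∀ j xs ts →
  atLeast j (concatMap (λ t → map (t ∷ʳ_) xs) ts) ≡ sumℕ (map (λ x → atLeast (j - + x) ts) xs)
atLeast-extensions j xs [] = sym (sumℕ-map-0 xs)
atLeast-extensions j xs (t ∷ ts) = begin
  atLeast j (map (t ∷ʳ_) xs ++ concatMap (λ t → map (t ∷ʳ_) xs) ts)
    ≡⟨ atLeast-++ j (map (t ∷ʳ_) xs) _ ⟩
  atLeast j (map (t ∷ʳ_) xs) ℕ.+ atLeast j (concatMap (λ t → map (t ∷ʳ_) xs) ts)
    ≡⟨ cong₂ ℕ._+_ (atLeast-map j (t ∷ʳ_) xs) (atLeast-extensions j xs ts) ⟩
  sumℕ (map (λ x → atLeast j [ t ∷ʳ x ]) xs) ℕ.+ sumℕ (map (λ x → atLeast (j - + x) ts) xs)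
    ≡⟨ sumℕ-map-+ (λ x → atLeast j [ t ∷ʳ x ]) (λ x → atLeast (j - + x) ts) xs ⟨
  sumℕ (map (λ x → atLeast j [ t ∷ʳ x ] ℕ.+ atLeast (j - + x) ts) xs)
    ≡⟨ cong sumℕ (map-cong (λ x → cong (ℕ._+ atLeast (j - + x) ts) (atLeast-map-∷ʳ j x [ t ])) xs) ⟩
  sumℕ (map (λ x → atLeast (j - + x) [ t ] ℕ.+ atLeast (j - + x) ts) xs)
    ≡⟨ cong sumℕ (map-cong (λ x → sym (atLeast-++ (j - + x) [ t ] ts)) xs) ⟩
  sumℕ (map (λ x → atLeast (j - + x) (t ∷ ts)) xs) ∎
  where open ≡-Reasoning

z-suc : ∀ X i j → z X (suc i) j ≡ sumℕ (map (λ x → z X i (j - + x)) (X (suc i)))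
z-suc X i j = atLeast-extensions j (X (suc i)) (choices X i)

module _ (R : RealField) where
  open RealField R renaming (_≤_ to _≤ᵣ_)
  open IsCommutativeRing isCommutativeRing using (+-assoc; +-comm; +-identityˡ; distribˡ; zeroʳ)
  open IsTotalOrder isTotalOrder using () renaming (refl to ≤ᵣ-refl; trans to ≤ᵣ-trans)

  +-mono-≤ᵣ : ∀ {a b c d} → a ≤ᵣ b → c ≤ᵣ d → a + c ≤ᵣ b + d
  +-mono-≤ᵣ {a} {b} {c} {d} a≤b c≤d = ≤ᵣ-trans (+-monoˡ-≤ c a≤b)
    (subst₂ _≤ᵣ_ (+-comm c b) (+-comm d b) (+-monoˡ-≤ b c≤d))

  sumR-mono : ∀ {A : Set} {f g : A → Carrier} xs →
    (∀ x → f x ≤ᵣ g x) → sumR (map f xs) ≤ᵣ sumR (map g xs)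
  sumR-mono [] f≤g = ≤ᵣ-refl
  sumR-mono (x ∷ xs) f≤g = +-mono-≤ᵣ (f≤g x) (sumR-mono xs f≤g)

  fromℕ-+ : ∀ a b → fromℕ (a ℕ.+ b) ≡ fromℕ a + fromℕ b
  fromℕ-+ zero b = sym (+-identityˡ (fromℕ b))
  fromℕ-+ (suc a) b = trans (cong (_+_ 1#) (fromℕ-+ a b)) (sym (+-assoc 1# (fromℕ a) (fromℕ b)))

  KApprox : Carrier → Carrier → ℕ → Set
  KApprox K r n = fromℕ n ≤ᵣ r × r ≤ᵣ K * fromℕ n

  KApprox-0 : ∀ K → KApprox K 0# 0
  KApprox-0 K = ≤ᵣ-refl , subst (0# ≤ᵣ_) (sym (zeroʳ K)) ≤ᵣ-refl

  KApprox-+ : ∀ {K r s} a b → KApprox K r a → KApprox K s b → KApprox K (r + s) (a ℕ.+ b)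
  KApprox-+ {K} {r} {s} a b (a≤r , r≤Ka) (b≤s , s≤Kb) =
    subst (_≤ᵣ r + s) (sym (fromℕ-+ a b)) (+-mono-≤ᵣ a≤r b≤s) ,
    subst (r + s ≤ᵣ_) (sym K*[a+b]≡K*a+K*b) (+-mono-≤ᵣ r≤Ka s≤Kb)
    where
    K*[a+b]≡K*a+K*b : K * fromℕ (a ℕ.+ b) ≡ K * fromℕ a + K * fromℕ b
    K*[a+b]≡K*a+K*b = trans (cong (K *_) (fromℕ-+ a b)) (distribˡ K (fromℕ a) (fromℕ b))

  KApprox-sum : ∀ {A : Set} {K} (f̃ : A → Carrier) (f : A → ℕ) xs →
    (∀ x → KApprox K (f̃ x) (f x)) → KApprox K (sumR (map f̃ xs)) (sumℕ (map f xs))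
  KApprox-sum f̃ f [] approx = KApprox-0 _
  KApprox-sum f̃ f (x ∷ xs) approx =
    KApprox-+ (f x) (sumℕ (map f xs)) (approx x) (KApprox-sum f̃ f xs approx)

mainTheorem1 : (R : RealField) → (m : ℕ) → 2 ≤ m → (X : ℕ → List ℕ) →
    (∀ k → 1 ≤ k → k ≤ m → Unique (X k) × ¬ (X k ≡ [])) →
    (K : RealField.Carrier R) → RealField._≤_ R (RealField.1# R) K →
    (i : ℕ) → 2 ≤ i → i ≤ m →
    (z̃ : ℤ → RealField.Carrier R) →
    Nonincreasing R z̃ → IsKApprox R K z̃ (z X (i ∸ 1)) →
    Nonincreasing R (λ j → RealField.sumR R (map (λ x → z̃ (j - + x)) (X i)))
    × IsKApprox R K (λ j → RealField.sumR R (map (λ x → z̃ (j - + x)) (X i))) (z X i)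
mainTheorem1 R _ _ X _ K _ (suc i) (s≤s _) _ z̃ z̃-nonincreasing z̃-approx = nonincreasing , approx
  where
  nonincreasing : Nonincreasing R (λ j → RealField.sumR R (map (λ x → z̃ (j - + x)) (X (suc i))))
  nonincreasing j j' j≤j' =
    sumR-mono R (X (suc i)) (λ x → z̃-nonincreasing _ _ (ℤ.+-monoˡ-≤ (ℤ.- + x) j≤j'))

  approx : IsKApprox R K (λ j → RealField.sumR R (map (λ x → z̃ (j - + x)) (X (suc i))))
                       (z X (suc i))
  approx j = subst (KApprox R K _) (sym (z-suc X i j))
    (KApprox-sum R _ _ (X (suc i)) (λ x → z̃-approx (j - + x)))
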